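{- (Subject reduction for closed terms.) If $\vdash t:A$ in the guarded $\lambda$-calculus and $t\twoheadrightarrow u$, then $\vdash u:A$.
   Context: The guarded $\lambda$-calculus ($\mathsf{g}\lambda$). Types: $A ::= \alpha \mid \mathbf{N} \mid \mathbf{1} \mid A\times A \mid \mathbf{0} \mid A+A \mid A\to A \mid \mu\alpha.A \mid \blacktriangleright A \mid \blacksquare A$. A judgement $\nabla\vdash A$ ($\nabla$ a finite set of type variables) is derived by: $\alpha\in\nabla$ gives $\nabla\vdash\alpha$; $\nabla\vdash\mathbf N,\mathbf 1,\mathbf 0$; $\times,+,\to$ from well-formed components; $\nabla\vdash\mu\alpha.A$ if $\nabla,\alpha\vdash A$ and $\alpha$ is guarded in $A$ (every occurrence of $\alpha$ lies beneath a $\blacktriangleright$); $\nabla\vdash\blacktriangleright A$ if $\nabla\vdash A$; $\nabla\vdash\blacksquare A$ if $\emptyset\vdash A$. Types are closed unless stated otherwise. A type is constant if every occurrence of $\blacktriangleright$ lies beneath a $\blacksquare$. Terms: $t ::= x \mid \mathsf{zero} \mid \mathsf{succ}\,t \mid \langle\rangle \mid \langle t,t\rangle \mid \pi_1 t \mid \pi_2 t \mid \mathsf{abort}\,t \mid \mathsf{in}_1 t \mid \mathsf{in}_2 t \mid \mathsf{case}\,t\,\mathsf{of}\,x_1.t;x_2.t \mid \lambda x.t \mid t\,t \mid \mathsf{fold}\,t \mid \mathsf{unfold}\,t \mid \mathsf{next}\,t \mid \mathsf{prev}\,\sigma.t \mid t\circledast t \mid \mathsf{box}\,\sigma.t \mid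 \mathsf{unbox}\,t \mid \mathsf{box}^+\sigma.t$, where $\sigma=[x_1\leftarrow t_1,\dots,x_n\leftarrow t_n]$ is an explicit substitution binding the $x_k$ in the body but not in the $t_k$; $\mathsf{prev}\,t,\mathsf{box}\,t,\mathsf{box}^+t$ denote $n=0$. Typing: the usual rules for variables, $\mathsf{zero}:\mathbf N$, $\mathsf{succ}$, $\langle\rangle:\mathbf 1$, pairs/projections, $\mathsf{abort}$ (from $\mathbf 0$ to any type), injections and case, abstraction and application; $\mathsf{fold}\,t:\mu\alpha.A$ if $t:A[\mu\alpha.A/\alpha]$, $\mathsf{unfold}\,t:A[\mu\alpha.A/\alpha]$ if $t:\mu\alpha.A$; $\mathsf{next}\,t:\blacktriangleright A$ if $t:A$; $t_1\circledast t_2:\blacktriangleright B$ if $t_1:\blacktriangleright(A\to B)$, $t_2:\blacktriangleright A$; $\mathsf{unbox}\,t:A$ if $t:\blacksquare A$; and, when $A_1,\dots,A_n$ are constant and $\Gamma\vdash t_k:A_k$: $\Gamma\vdash\mathsf{prev}[\vec x\leftarrow\vec t].t:A$ if $x_1{:}A_1,\dots,x_n{:}A_n\vdash t:\blacktriangleright A$; $\Gamma\vdash\mathsf{box}[\vec x\leftarrow\vec t].t:\blacksquare A$ if $\vec x{:}\vec A\vdash t:A$; $\Gamma\vdash\mathsf{box}^+[\vec x\leftarrow\vec t].t:\blacksquare B_1+\blacksquare B_2$ if $\vec x{:}\vec A\vdash t:B_1+B_2$. Reduction rules on closed terms: $\pi_d\langle t_1,t_2\rangle\mapsto t_d$; $\mathsf{case}\,\mathsf{in}_d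 t\,\mathsf{of}\,x_1.t_1;x_2.t_2\mapsto t_d[t/x_d]$; $(\lambda x.t_1)t_2\mapsto t_1[t_2/x]$; $\mathsf{unfold}\,\mathsf{fold}\,t\mapsto t$; $\mathsf{prev}[\vec x\leftarrow\vec t].t\mapsto\mathsf{prev}(t[\vec t/\vec x])$ ($\vec x$ nonempty); $\mathsf{prev}\,\mathsf{next}\,t\mapsto t$; $\mathsf{next}\,t_1\circledast\mathsf{next}\,t_2\mapsto\mathsf{next}(t_1t_2)$; $\mathsf{unbox}(\mathsf{box}[\vec x\leftarrow\vec t].t)\mapsto t[\vec t/\vec x]$; $\mathsf{box}^+[\vec x\leftarrow\vec t].t\mapsto\mathsf{box}^+(t[\vec t/\vec x])$ ($\vec x$ nonempty); $\mathsf{box}^+(\mathsf{in}_d t)\mapsto\mathsf{in}_d(\mathsf{box}\,t)$. Values: $\mathsf{succ}^n\mathsf{zero}$, $\langle\rangle$, $\langle t,t'\rangle$, $\mathsf{in}_d t$, $\lambda x.t$, $\mathsf{fold}\,t$, $\mathsf{next}\,t$, $\mathsf{box}\,\sigma.t$. Evaluation contexts: $E::=\cdot\mid\mathsf{succ}\,E\mid\pi_1E\mid\pi_2E\mid\mathsf{case}\,E\,\mathsf{of}\,x_1.t_1;x_2.t_2\mid E\,t\mid\mathsf{unfold}\,E\mid\mathsf{prev}\,E\mid E\circledast t\mid v\circledast E\ (v\text{ a value})\mid\mathsf{unbox}\,E\mid\mathsf{box}^+E$. Call-by-name reduction: $E[t]\mapsto E[u]$ whenever $t\mapsto u$ is a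 reduction rule; $\twoheadrightarrow$ is its reflexive–transitive closure. -}

module Defs where

open import Data.Nat using (ℕ; zero; suc; _<_)
open import Data.Fin using (Fin) renaming (zero to fz; suc to fs)
open import Data.Vec using (Vec; []; _∷_; lookup)
open import Data.Unit using (⊤)
open import Data.Empty using (⊥)
open import Data.Product using (_×_)
open import Relation.Binary.PropositionalEquality using (_≢_)
open import Relation.Binary.Construct.Closure.ReflexiveTransitive using (Star)

-- Types (type variables as de Bruijn indices; tv 0 is the innermost μ)

infixr 7 _⊗_
infixr 6 _⊕_
infixr 5 _⇒_

data Ty : Set where
  tv  : ℕ → Ty
  𝐍 𝟏 𝟎 : Ty
  _⊗_ _⊕_ _⇒_ : Ty → Ty → Ty
  μ_ : Ty → Ty
  ▶_ : Ty → Ty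
  ■_ : Ty → Ty

Guarded : ℕ → Ty → Set
Guarded i (tv j)  = j ≢ i
Guarded i 𝐍       = ⊤
Guarded i 𝟏       = ⊤
Guarded i 𝟎       = ⊤
Guarded i (A ⊗ B) = Guarded i A × Guarded i B
Guarded i (A ⊕ B) = Guarded i A × Guarded i B
Guarded i (A ⇒ B) = Guarded i A × Guarded i B
Guarded i (μ A)   = Guarded (suc i) A
Guarded i (▶ A)   = ⊤
Guarded i (■ A)   = Guarded i A

-- Well-formedness ∇ ⊢ A, with ∇ = the first m type variables
WF : ℕ → Ty → Set
WF m (tv i)  = i < m
WF m 𝐍       = ⊤
WF m 𝟏       = ⊤
WF m 𝟎       = ⊤
WF m (A ⊗ B) = WF m A × WF m B
WF m (A ⊕ B) = WF m A × WF m B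
WF m (A ⇒ B) = WF m A × WF m B
WF m (μ A)   = WF (suc m) A × Guarded 0 A
WF m (▶ A)   = WF m A
WF m (■ A)   = WF 0 A

Closed : Ty → Set
Closed A = WF 0 A

Constant : Ty → Set
Constant (tv i)  = ⊤
Constant 𝐍       = ⊤
Constant 𝟏       = ⊤
Constant 𝟎       = ⊤
Constant (A ⊗ B) = Constant A × Constant B
Constant (A ⊕ B) = Constant A × Constant B
Constant (A ⇒ B) = Constant A × Constant B
Constant (μ A)   = Constant A
Constant (▶ A)   = ⊥
Constant (■ A)   = ⊤

extTyR : (ℕ → ℕ) → ℕ → ℕ
extTyR ρ zero    = zero
extTyR ρ (suc i) = suc (ρ i)

renTy : (ℕ → ℕ) → Ty → Ty
renTy ρ (tv i)  = tv (ρ i)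
renTy ρ 𝐍       = 𝐍
renTy ρ 𝟏       = 𝟏
renTy ρ 𝟎       = 𝟎
renTy ρ (A ⊗ B) = renTy ρ A ⊗ renTy ρ B
renTy ρ (A ⊕ B) = renTy ρ A ⊕ renTy ρ B
renTy ρ (A ⇒ B) = renTy ρ A ⇒ renTy ρ B
renTy ρ (μ A)   = μ renTy (extTyR ρ) A
renTy ρ (▶ A)   = ▶ renTy ρ A
renTy ρ (■ A)   = ■ renTy ρ A

extTyS : (ℕ → Ty) → ℕ → Ty
extTyS σ zero    = tv zero
extTyS σ (suc i) = renTy suc (σ i)

substTy : (ℕ → Ty) → Ty → Ty
substTy σ (tv i)  = σ i
substTy σ 𝐍       = 𝐍
substTy σ 𝟏       = 𝟏
substTy σ 𝟎       = 𝟎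
substTy σ (A ⊗ B) = substTy σ A ⊗ substTy σ B
substTy σ (A ⊕ B) = substTy σ A ⊕ substTy σ B
substTy σ (A ⇒ B) = substTy σ A ⇒ substTy σ B
substTy σ (μ A)   = μ substTy (extTyS σ) A
substTy σ (▶ A)   = ▶ substTy σ A
substTy σ (■ A)   = ■ substTy σ A

single : Ty → ℕ → Ty
single B zero    = B
single B (suc i) = tv i

-- A [ B ]₀  is  A[B/α] where α is the variable bound by the enclosing μ
_[_]₀ : Ty → Ty → Ty
A [ B ]₀ = substTy (single B) A

-- Terms (well-scoped de Bruijn: Tm n has n free variables).
-- An explicit substitution [x₁←t₁,…,x_k←t_k] with t_i : Tm n is ESub n k;
-- the body of prev/box/box⁺ lives in Tm k: variable i of the body is x_{i+1}.

infixl 8 _·_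
infixl 7 _⊛_
infixr 5 _∷ₛ_

mutual
  data Tm (n : ℕ) : Set where
    var    : Fin n → Tm n
    zeroᵗ  : Tm n
    succ   : Tm n → Tm n
    ⟨⟩     : Tm n
    ⟨_,_⟩  : Tm n → Tm n → Tm n
    π₁ π₂  : Tm n → Tm n
    abort  : Tm n → Tm n
    in₁ in₂ : Tm n → Tm n
    case   : Tm n → Tm (suc n) → Tm (suc n) → Tm n
    lam    : Tm (suc n) → Tm n
    _·_    : Tm n → Tm n → Tm n
    fold   : Tm n → Tm n
    unfold : Tm n → Tm n
    next   : Tm n → Tm n
    prev   : ∀ {k} → ESub n k → Tm k → Tm n
    _⊛_    : Tm n → Tm n → Tm n
    box    : ∀ {k} → ESub n k → Tm k → Tm n
    unbox  : Tm n → Tm n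
    box⁺   : ∀ {k} → ESub n k → Tm k → Tm n

  data ESub (n : ℕ) : ℕ → Set where
    []ₛ  : ESub n zero
    _∷ₛ_ : ∀ {k} → Tm n → ESub n k → ESub n (suc k)

lookupₛ : ∀ {n k} → ESub n k → Fin k → Tm n
lookupₛ (t ∷ₛ σ) fz     = t
lookupₛ (t ∷ₛ σ) (fs i) = lookupₛ σ i

extR : ∀ {m n} → (Fin m → Fin n) → Fin (suc m) → Fin (suc n)
extR ρ fz     = fz
extR ρ (fs i) = fs (ρ i)

mutual
  ren : ∀ {m n} → (Fin m → Fin n) → Tm m → Tm n
  ren ρ (var i)      = var (ρ i)
  ren ρ zeroᵗ        = zeroᵗ
  ren ρ (succ t)     = succ (ren ρ t)
  ren ρ ⟨⟩           = ⟨⟩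
  ren ρ ⟨ t , u ⟩    = ⟨ ren ρ t , ren ρ u ⟩
  ren ρ (π₁ t)       = π₁ (ren ρ t)
  ren ρ (π₂ t)       = π₂ (ren ρ t)
  ren ρ (abort t)    = abort (ren ρ t)
  ren ρ (in₁ t)      = in₁ (ren ρ t)
  ren ρ (in₂ t)      = in₂ (ren ρ t)
  ren ρ (case t u v) = case (ren ρ t) (ren (extR ρ) u) (ren (extR ρ) v)
  ren ρ (lam t)      = lam (ren (extR ρ) t)
  ren ρ (t · u)      = ren ρ t · ren ρ u
  ren ρ (fold t)     = fold (ren ρ t)
  ren ρ (unfold t)   = unfold (ren ρ t)
  ren ρ (next t)     = next (ren ρ t)
  ren ρ (prev σ t)   = prev (renₛ ρ σ) t
  ren ρ (t ⊛ u)      = ren ρ t ⊛ ren ρ u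
  ren ρ (box σ t)    = box (renₛ ρ σ) t
  ren ρ (unbox t)    = unbox (ren ρ t)
  ren ρ (box⁺ σ t)   = box⁺ (renₛ ρ σ) t

  renₛ : ∀ {m n k} → (Fin m → Fin n) → ESub m k → ESub n k
  renₛ ρ []ₛ      = []ₛ
  renₛ ρ (t ∷ₛ σ) = ren ρ t ∷ₛ renₛ ρ σ

extS : ∀ {m n} → (Fin m → Tm n) → Fin (suc m) → Tm (suc n)
extS s fz     = var fz
extS s (fs i) = ren fs (s i)

mutual
  sub : ∀ {m n} → (Fin m → Tm n) → Tm m → Tm n
  sub s (var i)      = s i
  sub s zeroᵗ        = zeroᵗ
  sub s (succ t)     = succ (sub s t)
  sub s ⟨⟩           = ⟨⟩
  sub s ⟨ t , u ⟩    = ⟨ sub s t , sub s u ⟩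
  sub s (π₁ t)       = π₁ (sub s t)
  sub s (π₂ t)       = π₂ (sub s t)
  sub s (abort t)    = abort (sub s t)
  sub s (in₁ t)      = in₁ (sub s t)
  sub s (in₂ t)      = in₂ (sub s t)
  sub s (case t u v) = case (sub s t) (sub (extS s) u) (sub (extS s) v)
  sub s (lam t)      = lam (sub (extS s) t)
  sub s (t · u)      = sub s t · sub s u
  sub s (fold t)     = fold (sub s t)
  sub s (unfold t)   = unfold (sub s t)
  sub s (next t)     = next (sub s t)
  sub s (prev σ t)   = prev (subₛ s σ) t
  sub s (t ⊛ u)      = sub s t ⊛ sub s u
  sub s (box σ t)    = box (subₛ s σ) t
  sub s (unbox t)    = unbox (sub s t)
  sub s (box⁺ σ t)   = box⁺ (subₛ s σ) t

  subₛ : ∀ {m n k} → (Fin m → Tm n) → ESub m k → ESub n k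
  subₛ s []ₛ      = []ₛ
  subₛ s (t ∷ₛ σ) = sub s t ∷ₛ subₛ s σ

single-t : ∀ {n} → Tm n → Fin (suc n) → Tm n
single-t u fz     = u
single-t u (fs i) = var i

_[_] : ∀ {n} → Tm (suc n) → Tm n → Tm n
t [ u ] = sub (single-t u) t

_[_]ₛ : ∀ {n k} → Tm k → ESub n k → Tm n
t [ σ ]ₛ = sub (lookupₛ σ) t

Ctx : ℕ → Set
Ctx n = Vec Ty n

infix 4 _⊢_∶_ _⊢ₛ_∶_

mutual
  data _⊢_∶_ {n} (Γ : Ctx n) : Tm n → Ty → Set where
    ⊢var   : ∀ i → Γ ⊢ var i ∶ lookup Γ i
    ⊢zero  : Γ ⊢ zeroᵗ ∶ 𝐍
    ⊢succ  : ∀ {t} → Γ ⊢ t ∶ 𝐍 → Γ ⊢ succ t ∶ 𝐍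
    ⊢unit  : Γ ⊢ ⟨⟩ ∶ 𝟏
    ⊢pair  : ∀ {t u A B} → Γ ⊢ t ∶ A → Γ ⊢ u ∶ B → Γ ⊢ ⟨ t , u ⟩ ∶ A ⊗ B
    ⊢π₁    : ∀ {t A B} → Γ ⊢ t ∶ A ⊗ B → Γ ⊢ π₁ t ∶ A
    ⊢π₂    : ∀ {t A B} → Γ ⊢ t ∶ A ⊗ B → Γ ⊢ π₂ t ∶ B
    ⊢abort : ∀ {t A} → Closed A → Γ ⊢ t ∶ 𝟎 → Γ ⊢ abort t ∶ A
    ⊢in₁   : ∀ {t A B} → Closed B → Γ ⊢ t ∶ A → Γ ⊢ in₁ t ∶ A ⊕ B
    ⊢in₂   : ∀ {t A B} → Closed A → Γ ⊢ t ∶ B → Γ ⊢ in₂ t ∶ A ⊕ B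
    ⊢case  : ∀ {t t₁ t₂ A B C} → Γ ⊢ t ∶ A ⊕ B →
             (A ∷ Γ) ⊢ t₁ ∶ C → (B ∷ Γ) ⊢ t₂ ∶ C → Γ ⊢ case t t₁ t₂ ∶ C
    ⊢lam   : ∀ {t A B} → Closed A → (A ∷ Γ) ⊢ t ∶ B → Γ ⊢ lam t ∶ A ⇒ B
    ⊢app   : ∀ {t u A B} → Γ ⊢ t ∶ A ⇒ B → Γ ⊢ u ∶ A → Γ ⊢ t · u ∶ B
    ⊢fold  : ∀ {t A} → Closed (μ A) → Γ ⊢ t ∶ A [ μ A ]₀ → Γ ⊢ fold t ∶ μ A
    ⊢unfold : ∀ {t A} → Γ ⊢ t ∶ μ A → Γ ⊢ unfold t ∶ A [ μ A ]₀
    ⊢next  : ∀ {t A} → Γ ⊢ t ∶ A → Γ ⊢ next t ∶ ▶ A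
    ⊢⊛     : ∀ {t u A B} → Γ ⊢ t ∶ ▶ (A ⇒ B) → Γ ⊢ u ∶ ▶ A → Γ ⊢ t ⊛ u ∶ ▶ B
    ⊢unbox : ∀ {t A} → Γ ⊢ t ∶ ■ A → Γ ⊢ unbox t ∶ A
    ⊢prev  : ∀ {k} {σ : ESub n k} {Δ : Ctx k} {t A} →
             Γ ⊢ₛ σ ∶ Δ → Δ ⊢ t ∶ ▶ A → Γ ⊢ prev σ t ∶ A
    ⊢box   : ∀ {k} {σ : ESub n k} {Δ : Ctx k} {t A} →
             Γ ⊢ₛ σ ∶ Δ → Δ ⊢ t ∶ A → Γ ⊢ box σ t ∶ ■ A
    ⊢box⁺  : ∀ {k} {σ : ESub n k} {Δ : Ctx k} {t B₁ B₂} →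
             Γ ⊢ₛ σ ∶ Δ → Δ ⊢ t ∶ B₁ ⊕ B₂ → Γ ⊢ box⁺ σ t ∶ (■ B₁) ⊕ (■ B₂)

  data _⊢ₛ_∶_ {n} (Γ : Ctx n) : ∀ {k} → ESub n k → Ctx k → Set where
    ⊢[]ₛ : Γ ⊢ₛ []ₛ ∶ []
    ⊢∷ₛ  : ∀ {k t A} {σ : ESub n k} {Δ : Ctx k} →
           Closed A → Constant A → Γ ⊢ t ∶ A → Γ ⊢ₛ σ ∶ Δ →
           Γ ⊢ₛ (t ∷ₛ σ) ∶ (A ∷ Δ)

CTm : Set
CTm = Tm zero

infix 4 _↦_ _⟶_ _↠_

data _↦_ : CTm → CTm → Set where
  π₁-β    : ∀ {t₁ t₂} → π₁ ⟨ t₁ , t₂ ⟩ ↦ t₁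
  π₂-β    : ∀ {t₁ t₂} → π₂ ⟨ t₁ , t₂ ⟩ ↦ t₂
  case₁-β : ∀ {t t₁ t₂} → case (in₁ t) t₁ t₂ ↦ t₁ [ t ]
  case₂-β : ∀ {t t₁ t₂} → case (in₂ t) t₁ t₂ ↦ t₂ [ t ]
  lam-β   : ∀ {t₁ t₂} → lam t₁ · t₂ ↦ t₁ [ t₂ ]
  fold-β  : ∀ {t} → unfold (fold t) ↦ t
  prev-σ  : ∀ {k} {σ : ESub zero (suc k)} {t} → prev σ t ↦ prev []ₛ (t [ σ ]ₛ)
  prev-β  : ∀ {t} → prev []ₛ (next t) ↦ t
  next-⊛  : ∀ {t₁ t₂} → next t₁ ⊛ next t₂ ↦ next (t₁ · t₂)
  box-β   : ∀ {k} {σ : ESub zero k} {t} → unbox (box σ t) ↦ t [ σ ]ₛ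
  box⁺-σ  : ∀ {k} {σ : ESub zero (suc k)} {t} → box⁺ σ t ↦ box⁺ []ₛ (t [ σ ]ₛ)
  box⁺-in₁ : ∀ {t} → box⁺ []ₛ (in₁ t) ↦ in₁ (box []ₛ t)
  box⁺-in₂ : ∀ {t} → box⁺ []ₛ (in₂ t) ↦ in₂ (box []ₛ t)

data Numeral : CTm → Set where
  num-zero : Numeral zeroᵗ
  num-succ : ∀ {t} → Numeral t → Numeral (succ t)

data Value : CTm → Set where
  v-num  : ∀ {t} → Numeral t → Value t
  v-unit : Value ⟨⟩
  v-pair : ∀ {t u} → Value ⟨ t , u ⟩
  v-in₁  : ∀ {t} → Value (in₁ t)
  v-in₂  : ∀ {t} → Value (in₂ t)
  v-lam  : ∀ {t} → Value (lam t)
  v-fold : ∀ {t} → Value (fold t)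
  v-next : ∀ {t} → Value (next t)
  v-box  : ∀ {k} {σ : ESub zero k} {t} → Value (box σ t)

data EvCtx : Set where
  ∙       : EvCtx
  succE   : EvCtx → EvCtx
  π₁E π₂E : EvCtx → EvCtx
  caseE   : EvCtx → Tm (suc zero) → Tm (suc zero) → EvCtx
  appE    : EvCtx → CTm → EvCtx
  unfoldE : EvCtx → EvCtx
  prevE   : EvCtx → EvCtx
  ⊛ˡE     : EvCtx → CTm → EvCtx
  ⊛ʳE     : (v : CTm) → Value v → EvCtx → EvCtx
  unboxE  : EvCtx → EvCtx
  box⁺E   : EvCtx → EvCtx

plug : EvCtx → CTm → CTm
plug ∙ t             = t
plug (succE E) t     = succ (plug E t)
plug (π₁E E) t       = π₁ (plug E t)
plug (π₂E E) t       = π₂ (plug E t)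
plug (caseE E u v) t = case (plug E t) u v
plug (appE E u) t    = plug E t · u
plug (unfoldE E) t   = unfold (plug E t)
plug (prevE E) t     = prev []ₛ (plug E t)
plug (⊛ˡE E u) t     = plug E t ⊛ u
plug (⊛ʳE v _ E) t   = v ⊛ plug E t
plug (unboxE E) t    = unbox (plug E t)
plug (box⁺E E) t     = box⁺ []ₛ (plug E t)

data _⟶_ : CTm → CTm → Set where
  step : ∀ (E : EvCtx) {t u} → t ↦ u → plug E t ⟶ plug E u

_↠_ : CTm → CTm → Set
_↠_ = Star _⟶_

module Submission where

-- The proof is the standard syntactic one.
--   1. Typing is stable under renaming and under parallel substitution of
--      well-typed terms (ren-⊢, sub-⊢).  Since the bodies of prev, box and
--      box⁺ are typed in their own context Δ and never touched by
--      substitution, only the explicit substitutions σ must be transported,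
--      which is done simultaneously (renₛ-⊢, subₛ-⊢).
--   2. Each reduction rule preserves types (head-preserves); the β-rules use
--      the substitution lemma with a single term or with the terms listed in
--      an explicit substitution.
--   3. Replacing the hole of an evaluation context by a term having every type
--      the old one had preserves typing (plug-⊢), so one call-by-name step
--      preserves types.
--   4. Type preservation of a relation lifts to its reflexive–transitive
--      closure (star-preserves), which gives the theorem.

open import Defs
open import Data.Fin using (Fin) renaming (zero to fz; suc to fs)
open import Data.Vec using ([]; _∷_; lookup)
open import Relation.Binary.PropositionalEquality using (_≡_; refl; subst)
open import Relation.Binary.Construct.Closure.ReflexiveTransitive using (Star; ε; _◅_)

TypedRen : ∀ {m n} → Ctx m → Ctx n → (Fin m → Fin n) → Set
TypedRen {m} Γ Δ ρ = (i : Fin m) → lookup Δ (ρ i) ≡ lookup Γ i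

extR-typed : ∀ {m n} {Γ : Ctx m} {Δ : Ctx n} {ρ A} →
             TypedRen Γ Δ ρ → TypedRen (A ∷ Γ) (A ∷ Δ) (extR ρ)
extR-typed ok fz     = refl
extR-typed ok (fs i) = ok i

mutual
  ren-⊢ : ∀ {m n} {Γ : Ctx m} {Δ : Ctx n} {ρ t A} →
          TypedRen Γ Δ ρ → Γ ⊢ t ∶ A → Δ ⊢ ren ρ t ∶ A
  ren-⊢ {Δ = Δ} {ρ} ok (⊢var i) = subst (Δ ⊢ var (ρ i) ∶_) (ok i) (⊢var (ρ i))
  ren-⊢ ok ⊢zero         = ⊢zero
  ren-⊢ ok (⊢succ d)     = ⊢succ (ren-⊢ ok d)
  ren-⊢ ok ⊢unit         = ⊢unit
  ren-⊢ ok (⊢pair d e)   = ⊢pair (ren-⊢ ok d) (ren-⊢ ok e)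
  ren-⊢ ok (⊢π₁ d)       = ⊢π₁ (ren-⊢ ok d)
  ren-⊢ ok (⊢π₂ d)       = ⊢π₂ (ren-⊢ ok d)
  ren-⊢ ok (⊢abort c d)  = ⊢abort c (ren-⊢ ok d)
  ren-⊢ ok (⊢in₁ c d)    = ⊢in₁ c (ren-⊢ ok d)
  ren-⊢ ok (⊢in₂ c d)    = ⊢in₂ c (ren-⊢ ok d)
  ren-⊢ ok (⊢case d e f) =
    ⊢case (ren-⊢ ok d) (ren-⊢ (extR-typed ok) e) (ren-⊢ (extR-typed ok) f)
  ren-⊢ ok (⊢lam c d)    = ⊢lam c (ren-⊢ (extR-typed ok) d)
  ren-⊢ ok (⊢app d e)    = ⊢app (ren-⊢ ok d) (ren-⊢ ok e)
  ren-⊢ ok (⊢fold c d)   = ⊢fold c (ren-⊢ ok d)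
  ren-⊢ ok (⊢unfold d)   = ⊢unfold (ren-⊢ ok d)
  ren-⊢ ok (⊢next d)     = ⊢next (ren-⊢ ok d)
  ren-⊢ ok (⊢⊛ d e)      = ⊢⊛ (ren-⊢ ok d) (ren-⊢ ok e)
  ren-⊢ ok (⊢unbox d)    = ⊢unbox (ren-⊢ ok d)
  ren-⊢ ok (⊢prev s d)   = ⊢prev (renₛ-⊢ ok s) d
  ren-⊢ ok (⊢box s d)    = ⊢box (renₛ-⊢ ok s) d
  ren-⊢ ok (⊢box⁺ s d)   = ⊢box⁺ (renₛ-⊢ ok s) d

  renₛ-⊢ : ∀ {m n k} {Γ : Ctx m} {Δ : Ctx n} {ρ} {σ : ESub m k} {Θ : Ctx k} →
           TypedRen Γ Δ ρ → Γ ⊢ₛ σ ∶ Θ → Δ ⊢ₛ renₛ ρ σ ∶ Θ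
  renₛ-⊢ ok ⊢[]ₛ            = ⊢[]ₛ
  renₛ-⊢ ok (⊢∷ₛ c k d s)   = ⊢∷ₛ c k (ren-⊢ ok d) (renₛ-⊢ ok s)

weaken-⊢ : ∀ {n} {Γ : Ctx n} {t A B} → Γ ⊢ t ∶ A → (B ∷ Γ) ⊢ ren fs t ∶ A
weaken-⊢ = ren-⊢ (λ _ → refl)

TypedSub : ∀ {m n} → Ctx m → Ctx n → (Fin m → Tm n) → Set
TypedSub {m} Γ Δ s = (i : Fin m) → Δ ⊢ s i ∶ lookup Γ i

extS-typed : ∀ {m n} {Γ : Ctx m} {Δ : Ctx n} {s A} →
             TypedSub Γ Δ s → TypedSub (A ∷ Γ) (A ∷ Δ) (extS s)
extS-typed ok fz     = ⊢var fz
extS-typed ok (fs i) = weaken-⊢ (ok i)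

mutual
  sub-⊢ : ∀ {m n} {Γ : Ctx m} {Δ : Ctx n} {s t A} →
          TypedSub Γ Δ s → Γ ⊢ t ∶ A → Δ ⊢ sub s t ∶ A
  sub-⊢ ok (⊢var i)      = ok i
  sub-⊢ ok ⊢zero         = ⊢zero
  sub-⊢ ok (⊢succ d)     = ⊢succ (sub-⊢ ok d)
  sub-⊢ ok ⊢unit         = ⊢unit
  sub-⊢ ok (⊢pair d e)   = ⊢pair (sub-⊢ ok d) (sub-⊢ ok e)
  sub-⊢ ok (⊢π₁ d)       = ⊢π₁ (sub-⊢ ok d)
  sub-⊢ ok (⊢π₂ d)       = ⊢π₂ (sub-⊢ ok d)
  sub-⊢ ok (⊢abort c d)  = ⊢abort c (sub-⊢ ok d)
  sub-⊢ ok (⊢in₁ c d)    = ⊢in₁ c (sub-⊢ ok d)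
  sub-⊢ ok (⊢in₂ c d)    = ⊢in₂ c (sub-⊢ ok d)
  sub-⊢ ok (⊢case d e f) =
    ⊢case (sub-⊢ ok d) (sub-⊢ (extS-typed ok) e) (sub-⊢ (extS-typed ok) f)
  sub-⊢ ok (⊢lam c d)    = ⊢lam c (sub-⊢ (extS-typed ok) d)
  sub-⊢ ok (⊢app d e)    = ⊢app (sub-⊢ ok d) (sub-⊢ ok e)
  sub-⊢ ok (⊢fold c d)   = ⊢fold c (sub-⊢ ok d)
  sub-⊢ ok (⊢unfold d)   = ⊢unfold (sub-⊢ ok d)
  sub-⊢ ok (⊢next d)     = ⊢next (sub-⊢ ok d)
  sub-⊢ ok (⊢⊛ d e)      = ⊢⊛ (sub-⊢ ok d) (sub-⊢ ok e)
  sub-⊢ ok (⊢unbox d)    = ⊢unbox (sub-⊢ ok d)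
  sub-⊢ ok (⊢prev s d)   = ⊢prev (subₛ-⊢ ok s) d
  sub-⊢ ok (⊢box s d)    = ⊢box (subₛ-⊢ ok s) d
  sub-⊢ ok (⊢box⁺ s d)   = ⊢box⁺ (subₛ-⊢ ok s) d

  subₛ-⊢ : ∀ {m n k} {Γ : Ctx m} {Δ : Ctx n} {s} {σ : ESub m k} {Θ : Ctx k} →
           TypedSub Γ Δ s → Γ ⊢ₛ σ ∶ Θ → Δ ⊢ₛ subₛ s σ ∶ Θ
  subₛ-⊢ ok ⊢[]ₛ            = ⊢[]ₛ
  subₛ-⊢ ok (⊢∷ₛ c k d s)   = ⊢∷ₛ c k (sub-⊢ ok d) (subₛ-⊢ ok s)

single-typed : ∀ {n} {Γ : Ctx n} {u A} → Γ ⊢ u ∶ A → TypedSub (A ∷ Γ) Γ (single-t u)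
single-typed d fz     = d
single-typed d (fs i) = ⊢var i

lookupₛ-typed : ∀ {n k} {Γ : Ctx n} {σ : ESub n k} {Θ : Ctx k} →
                Γ ⊢ₛ σ ∶ Θ → TypedSub Θ Γ (lookupₛ σ)
lookupₛ-typed (⊢∷ₛ c k d s) fz     = d
lookupₛ-typed (⊢∷ₛ c k d s) (fs i) = lookupₛ-typed s i

PreservesTypes : (CTm → CTm → Set) → Set
PreservesTypes R = ∀ {t u A} → [] ⊢ t ∶ A → R t u → [] ⊢ u ∶ A

head-preserves : PreservesTypes _↦_
head-preserves (⊢π₁ (⊢pair d e))              π₁-β     = d
head-preserves (⊢π₂ (⊢pair d e))              π₂-β     = e
head-preserves (⊢case (⊢in₁ c d) e f)         case₁-β  = sub-⊢ (single-typed d) e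
head-preserves (⊢case (⊢in₂ c d) e f)         case₂-β  = sub-⊢ (single-typed d) f
head-preserves (⊢app (⊢lam c e) d)            lam-β    = sub-⊢ (single-typed d) e
head-preserves (⊢unfold (⊢fold c d))          fold-β   = d
head-preserves (⊢prev s d)                    prev-σ   = ⊢prev ⊢[]ₛ (sub-⊢ (lookupₛ-typed s) d)
head-preserves (⊢prev ⊢[]ₛ (⊢next d))         prev-β   = d
head-preserves (⊢⊛ (⊢next d) (⊢next e))       next-⊛   = ⊢next (⊢app d e)
head-preserves (⊢unbox (⊢box s d))            box-β    = sub-⊢ (lookupₛ-typed s) d
head-preserves (⊢box⁺ s d)                    box⁺-σ   = ⊢box⁺ ⊢[]ₛ (sub-⊢ (lookupₛ-typed s) d)
head-preserves (⊢box⁺ ⊢[]ₛ (⊢in₁ c d))        box⁺-in₁ = ⊢in₁ c (⊢box ⊢[]ₛ d)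
head-preserves (⊢box⁺ ⊢[]ₛ (⊢in₂ c d))        box⁺-in₂ = ⊢in₂ c (⊢box ⊢[]ₛ d)

-- Replacement: if u has every type that t has, then so does E[u] for E[t].
-- Holes of evaluation contexts never sit under a binder, so the context stays empty.
plug-⊢ : ∀ E {t u} → (∀ {B} → [] ⊢ t ∶ B → [] ⊢ u ∶ B) →
         ∀ {A} → [] ⊢ plug E t ∶ A → [] ⊢ plug E u ∶ A
plug-⊢ ∙               t⇒u d                = t⇒u d
plug-⊢ (succE E)       t⇒u (⊢succ d)        = ⊢succ (plug-⊢ E t⇒u d)
plug-⊢ (π₁E E)         t⇒u (⊢π₁ d)          = ⊢π₁ (plug-⊢ E t⇒u d)
plug-⊢ (π₂E E)         t⇒u (⊢π₂ d)          = ⊢π₂ (plug-⊢ E t⇒u d)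
plug-⊢ (caseE E _ _)   t⇒u (⊢case d e f)    = ⊢case (plug-⊢ E t⇒u d) e f
plug-⊢ (appE E _)      t⇒u (⊢app d e)       = ⊢app (plug-⊢ E t⇒u d) e
plug-⊢ (unfoldE E)     t⇒u (⊢unfold d)      = ⊢unfold (plug-⊢ E t⇒u d)
plug-⊢ (prevE E)       t⇒u (⊢prev ⊢[]ₛ d)   = ⊢prev ⊢[]ₛ (plug-⊢ E t⇒u d)
plug-⊢ (⊛ˡE E _)       t⇒u (⊢⊛ d e)         = ⊢⊛ (plug-⊢ E t⇒u d) e
plug-⊢ (⊛ʳE _ _ E)     t⇒u (⊢⊛ d e)         = ⊢⊛ d (plug-⊢ E t⇒u e)
plug-⊢ (unboxE E)      t⇒u (⊢unbox d)       = ⊢unbox (plug-⊢ E t⇒u d)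
plug-⊢ (box⁺E E)       t⇒u (⊢box⁺ ⊢[]ₛ d)   = ⊢box⁺ ⊢[]ₛ (plug-⊢ E t⇒u d)

step-preserves : PreservesTypes _⟶_
step-preserves d (step E r) = plug-⊢ E (λ d′ → head-preserves d′ r) d

star-preserves : ∀ {R} → PreservesTypes R → PreservesTypes (Star R)
star-preserves pres d ε        = d
star-preserves pres d (r ◅ rs) = star-preserves pres (pres d r) rs

lemma1p8 : ∀ {t u : CTm} {A : Ty} → [] ⊢ t ∶ A → t ↠ u → [] ⊢ u ∶ A
lemma1p8 = star-preserves step-preserves
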